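{- Let $m\ge 4$, $n\ge 1$, and let $T$ be a triangulation of $G_{m,n}$ containing neither $W_5$ nor $W_7$ as an induced subgraph (so that, for each $2\le i\le n$, all cells of layer $L_i$ have a common type, called the type of $L_i$). Define the orientation $O$ of $T$ as follows. Horizontal edges: for all $0\le x\le n$, orient $v_{x0}\to v_{x,m-1}$, $v_{x,m-1}\to v_{x,m-2}$, and $v_{xy}\to v_{x,y+1}$ for $0\le y\le m-3$. Diagonal edges: a diagonal edge of a cell joins a vertex on one of the two vertical lines of that cell to a vertex on the other; orient it from the line that is the tail of the cell's horizontal edges to the line that is their head. Vertical edges: $v_{0y}\to v_{1y}$ for all $0\le y\le m-1$; and for $1\le x\le n-1$ and $0\le y\le m-1$, the edge $v_{xy}v_{x+1,y}$ is oriented in the same direction (i.e. outward $v_{xy}\to v_{x+1,y}$ iff $v_{x-1,y}\to v_{xy}$) as $v_{x-1,y}v_{xy}$ if $L_{x+1}$ is of type $A$, and in the opposite direction if $L_{x+1}$ is of type $B$. Then $O$ is a semi-transitive orientation of $T$.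
   Context: $G_{m,n}$ has vertex set $\{v_{ij}: 0\le i\le n,\ 0\le j\le m-1\}$, horizontal edges $v_{ij}v_{i,j+1}$ (second index mod $m$) and vertical edges $v_{ij}v_{i+1,j}$; the vertical line $V_y$ is $\{v_{iy}:0\le i\le n\}$. Cells are the 4-cycles $v_{ij}v_{i+1,j}v_{i+1,j+1}v_{i,j+1}$ (second index mod $m$), the cell with first index $i$ lying in layer $L_{i+1}$. A triangulation adds one diagonal to each cell. For $1\le i\le n-1$ the cell $v_{ij}v_{i+1,j}v_{i+1,j+1}v_{i,j+1}$ is of type $A$ if its diagonal shares no vertex with the diagonal of the cell $v_{i-1,j}v_{ij}v_{i,j+1}v_{i-1,j+1}$, and of type $B$ otherwise. $W_k$ is the wheel graph (cycle $C_k$ plus a vertex adjacent to all its vertices). An orientation of a graph is semi-transitive if it is acyclic and for every directed path $u_1\to u_2\to\cdots\to u_k$ ($k\ge 2$) such that the arc $u_1\to u_k$ is present, all arcs $u_i\to u_j$ with $1\le i<j\le k$ are present (equivalently, it is acyclic and has no shortcut). -}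

module Defs where

open import Data.Nat using (ℕ; zero; suc; _+_; _≤ᵇ_)
open import Data.Nat.DivMod using (_mod_)
open import Data.Fin using (Fin; zero; suc; toℕ; inject₁)
import Data.Fin.Properties as FinP
open import Data.Bool using (Bool; true; false; if_then_else_; not; _∨_)
open import Data.Product using (Σ; _×_; _,_; ∃)
open import Data.Product.Properties using (≡-dec)
open import Data.Sum using (_⊎_)
open import Data.List using (List; []; _∷_; _∷ʳ_)
open import Data.List.Relation.Unary.Linked using (Linked)
open import Data.List.Relation.Unary.AllPairs using (AllPairs)
open import Relation.Nullary using (¬_; does)
open import Relation.Binary.PropositionalEquality using (_≡_)
open import Function using (Injective)
open import Data.Empty using (⊥)
open import Data.Unit using (⊤)
open import Function.Bundles using (_⇔_)

next : ∀ {m} → Fin m → Fin m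
next {zero} ()
next {suc k} y = suc (toℕ y) mod (suc k)

-- Wheel W_k on vertex set Fin (suc k): vertex 0 is the hub,
-- vertices suc i (i : Fin k) form the cycle C_k (i adjacent to i+1 mod k).
WheelAdj : (k : ℕ) → Fin (suc k) → Fin (suc k) → Set
WheelAdj k zero    zero    = ⊥
WheelAdj k zero    (suc j) = ⊤
WheelAdj k (suc i) zero    = ⊤
WheelAdj k (suc i) (suc j) = (j ≡ next i) ⊎ (i ≡ next j)

InducedSub : ∀ {V : Set} (Adj : V → V → Set) {h : ℕ} (HAdj : Fin h → Fin h → Set) → Set
InducedSub {V} Adj {h} HAdj =
  Σ (Fin h → V) λ f → Injective _≡_ _≡_ f × (∀ a b → HAdj a b ⇔ Adj (f a) (f b))

Acyclic : ∀ {V : Set} → (V → V → Set) → Set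
Acyclic {V} Arc = ∀ (u : V) (xs : List V) → ¬ Linked Arc (u ∷ (xs ∷ʳ u))

SemiTransitive : ∀ {V : Set} → (V → V → Set) → Set
SemiTransitive {V} Arc =
  Acyclic Arc ×
  (∀ (u w : V) (mid : List V) →
     Linked Arc (u ∷ (mid ∷ʳ w)) → Arc u w → AllPairs Arc (u ∷ (mid ∷ʳ w)))

-- vertex v_{ij} = (i , j), 0 ≤ i ≤ n, j ∈ ℤ_m
Vtx : ℕ → ℕ → Set
Vtx m n = Fin (suc n) × Fin m

-- A triangulation: for each cell (i , j) (0 ≤ i ≤ n-1) the chosen diagonal;
-- true  = v_{i,j} v_{i+1,j+1}
-- false = v_{i+1,j} v_{i,j+1}
Tri : ℕ → ℕ → Set
Tri m n = Fin n → Fin m → Bool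

-- Edges of the triangulated graph:
-- hor x y : v_{x,y} v_{x,y+1};  ver x y : v_{x,y} v_{x+1,y};  dia x y : diagonal of cell (x,y)
data Edge (m n : ℕ) : Set where
  hor : Fin (suc n) → Fin m → Edge m n
  ver : Fin n → Fin m → Edge m n
  dia : Fin n → Fin m → Edge m n

-- endpoints of the diagonal of cell (x , y), listed as
-- (endpoint on line V_y , endpoint on line V_{y+1})
diagEnds : ∀ {m n} → Tri m n → Fin n → Fin m → Vtx m n × Vtx m n
diagEnds T x y with T x y
... | true  = (inject₁ x , y) , (suc x , next y)
... | false = (suc x , y) , (inject₁ x , next y)

ends : ∀ {m n} → Tri m n → Edge m n → Vtx m n × Vtx m n
ends T (hor x y) = (x , y) , (x , next y)
ends T (ver x y) = (inject₁ x , y) , (suc x , y)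
ends T (dia x y) = diagEnds T x y

Adj : ∀ {m n} → Tri m n → Vtx m n → Vtx m n → Set
Adj {m} {n} T u v = Σ (Edge m n) λ e → (ends T e ≡ (u , v)) ⊎ (ends T e ≡ (v , u))

_≟V_ : ∀ {m n} (u v : Vtx m n) → Relation.Nullary.Dec (u ≡ v)
_≟V_ = ≡-dec FinP._≟_ FinP._≟_
  where import Relation.Nullary

shareVertex : ∀ {m n} → Vtx m n × Vtx m n → Vtx m n × Vtx m n → Bool
shareVertex (a , b) (c , d) =
  does (a ≟V c) ∨ does (a ≟V d) ∨ does (b ≟V c) ∨ does (b ≟V d)

-- the cell (x+1 , y) (1 ≤ x+1 ≤ n-1) is of type A: its diagonal shares no vertex
-- with the diagonal of the cell (x , y) below it.  (false means type B)
isTypeA : ∀ {m n} → Tri m (suc n) → Fin n → Fin m → Bool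
isTypeA T x y = not (shareVertex (diagEnds T (suc x) y) (diagEnds T (inject₁ x) y))

restrict : ∀ {m n} → Tri m (suc n) → Tri m n
restrict T i j = T (inject₁ i) j

-- orientation of the vertical edge v_{x,y} v_{x+1,y}: true means v_{x,y} → v_{x+1,y}.
-- v_{0y} → v_{1y}; for x ≥ 1 same direction as v_{x-1,y}v_{x,y} if layer L_{x+1}
-- is of type A, opposite if type B (type of L_{x+1} read off from its cell in column y).
up : ∀ {m n} → Tri m n → Fin n → Fin m → Bool
up T zero y = true
up {n = suc n} T (suc x) y =
  if isTypeA T x y then up (restrict T) x y else not (up (restrict T) x y)

-- horizontal edge v_{·,y} v_{·,y+1} oriented from column y to column y+1
-- iff 0 ≤ y ≤ m-3 (otherwise from y+1 to y).
forward : ∀ {m} → Fin m → Bool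
forward {m} y = toℕ y + 3 ≤ᵇ m

-- whether the edge is oriented from the first to the second listed endpoint
dir : ∀ {m n} → Tri m n → Edge m n → Bool
dir T (hor x y) = forward y
dir T (ver x y) = up T x y
dir T (dia x y) = forward y

swap : ∀ {A : Set} → A × A → A × A
swap (a , b) = b , a

orient : ∀ {m n} → Tri m n → Edge m n → Vtx m n × Vtx m n
orient T e = if dir T e then ends T e else swap (ends T e)

Arc : ∀ {m n} → Tri m n → Vtx m n → Vtx m n → Set
Arc {m} {n} T u v = Σ (Edge m n) λ e → orient T e ≡ (u , v)

module Submission where

-- Number the columns 0 … M (M = m - 1).  The horizontal edges orient the columns
-- as the column digraph 0 → 1 → … → M-1, 0 → M → M-1, which has a strictly increasing
-- rank and no detours; every arc of O stays in its column or follows a column arc.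
-- Call the columns j, j+1 the ladder j.  Once each layer has a single cell type, the
-- vertical edges of neighbouring columns point alike, and the ladder j carries a
-- potential φ_j (height along the vertical edges plus a jump of 1 or 2 on the head
-- column) that every arc inside the ladder raises by one or two.  Hence closed walks do
-- not exist, and a path parallel to an arc u → w stays in the ladder of that arc and
-- has at most two arcs, so all required arcs are present.

open import Defs
open import Function using (_∘_)
open import Data.Nat using (ℕ; zero; suc; _≤_; _<_; z≤n; s≤s)
open import Data.Fin using (Fin; zero; suc; inject₁; toℕ)
open import Data.Fin.Properties using (toℕ-injective; inject₁-injective) renaming (_≟_ to _≟ᶠ_)
open import Data.Bool using (Bool; true; false; not; _xor_; if_then_else_)
open import Data.Bool.Properties using () renaming (_≟_ to _≟ᵇ_)
open import Data.Product using (Σ; _×_; _,_; proj₁; proj₂)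
open import Data.Sum using (_⊎_; inj₁; inj₂)
open import Data.Empty using (⊥; ⊥-elim)
open import Relation.Nullary using (¬_; Dec; yes; no; does)
open import Relation.Nullary.Decidable using (dec-true; dec-false)
open import Relation.Binary using (DecidableEquality)
open import Relation.Binary.PropositionalEquality

module Walks where

  open import Data.Nat using (_+_)
  open import Data.Nat.Properties using (≤-refl; ≤-trans; <⇒≤; ≤-reflexive; <-irrefl; +-mono-≤)
  open import Data.Integer using (ℤ; +_) renaming (_+_ to _+ℤ_)
  open import Data.Integer.Properties using (+-assoc; pos-+; +-injective; +-identityʳ; +-0-abelianGroup)
  open import Algebra.Bundles using (AbelianGroup)
  open import Algebra.Properties.Group (AbelianGroup.group +-0-abelianGroup) using (∙-cancelˡ)
  open import Data.List using (List; []; _∷_; _∷ʳ_; length)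
  open import Data.List.Relation.Unary.Linked using (Linked; [-]; _∷_)
  open import Data.List.Relation.Unary.All using (All; []; _∷_)
  import Data.List.Relation.Unary.All as All
  open import Data.List.Relation.Unary.AllPairs using (AllPairs; []; _∷_)
  import Data.Sum as Sum

  Rise : ℤ → ℤ → Set
  Rise a b = Σ ℕ λ d → 1 ≤ d × d ≤ 2 × b ≡ a +ℤ + d

  rise-equal : ∀ (a : ℤ) {k d} → a +ℤ + k ≡ a +ℤ + d → k ≡ d
  rise-equal a eq = +-injective (∙-cancelˡ a _ _ eq)

  module _ {V : Set} (R : V → V → Set) where

    Walk : V → List V → V → Set
    Walk u mid w = Linked R (u ∷ (mid ∷ʳ w))

    first-arc : ∀ {u w} mid → Walk u mid w → Σ V (R u)
    first-arc {w = w} [] (r ∷ [-]) = w , r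
    first-arc (z ∷ _) (r ∷ _) = z , r

    module Potential (P : V → Set) (φ : V → ℤ)
                     (rise : ∀ {a b} → P a → P b → R a b → Rise (φ a) (φ b)) where

      walk-rise : ∀ u mid w → Walk u mid w → P u → All P mid → P w →
                  Σ ℕ λ k → length mid < k × φ w ≡ φ u +ℤ + k
      walk-rise u [] w (r ∷ [-]) pu [] pw with rise pu pw r
      ... | d , 1≤d , _ , eq = d , 1≤d , eq
      walk-rise u (z ∷ mid) w (r ∷ rs) pu (pz ∷ pmid) pw
        with rise pu pz r | walk-rise z mid w rs pz pmid pw
      ... | d , 1≤d , _ , eq | k , len<k , eq' =
        d + k , +-mono-≤ 1≤d len<k ,
        (begin
          φ w                  ≡⟨ eq' ⟩
          φ z +ℤ + k           ≡⟨ cong (_+ℤ + k) eq ⟩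
          φ u +ℤ + d +ℤ + k    ≡⟨ +-assoc (φ u) (+ d) (+ k) ⟩
          φ u +ℤ (+ d +ℤ + k)  ≡⟨ cong (φ u +ℤ_) (sym (pos-+ d k)) ⟩
          φ u +ℤ + (d + k)     ∎)
        where open ≡-Reasoning

    module Layered {C : Set} (layer : V → C) (S : C → C → Set) (rank : C → ℕ)
                   (rank-mono : ∀ {a b} → S a b → rank a < rank b)
                   (over : ∀ {u v} → R u v → layer u ≡ layer v ⊎ S (layer u) (layer v)) where

      walk-rank : ∀ u mid w → Walk u mid w → rank (layer u) ≤ rank (layer w)
      walk-rank u [] w (r ∷ [-]) with over r
      ... | inj₁ same = ≤-reflexive (cong rank same)
      ... | inj₂ s    = <⇒≤ (rank-mono s)
      walk-rank u (z ∷ mid) w (r ∷ rs) with over r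
      ... | inj₁ same = ≤-trans (≤-reflexive (cong rank same)) (walk-rank z mid w rs)
      ... | inj₂ s    = ≤-trans (<⇒≤ (rank-mono s)) (walk-rank z mid w rs)

      walk-flat : ∀ u mid w → Walk u mid w → layer u ≡ layer w → All (λ z → layer z ≡ layer u) mid
      walk-flat u [] w _ _ = []
      walk-flat u (z ∷ mid) w (r ∷ rs) uw with over r
      ... | inj₁ same = sym same ∷ All.map (λ e → trans e (sym same)) (walk-flat z mid w rs (trans (sym same) uw))
      ... | inj₂ s = ⊥-elim (<-irrefl refl (≤-trans (rank-mono s)
                                            (≤-trans (walk-rank z mid w rs) (≤-reflexive (cong rank (sym uw))))))

      walk-exit : ∀ u mid w → Walk u mid w → layer u ≢ layer w →
                  Σ C λ s → S (layer u) s × rank s ≤ rank (layer w)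
      walk-exit u [] w (r ∷ [-]) u≢w with over r
      ... | inj₁ same = ⊥-elim (u≢w same)
      ... | inj₂ s    = layer w , s , ≤-refl
      walk-exit u (z ∷ mid) w (r ∷ rs) u≢w with over r
      ... | inj₂ s    = layer z , s , walk-rank z mid w rs
      ... | inj₁ same with walk-exit z mid w rs (λ e → u≢w (trans same e))
      ... | s , step , le = s , subst (λ c → S c s) (sym same) step , le

      walk-beside : DecidableEquality C →
                    (∀ {a b s s'} → S a b → S a s → s ≢ b → S s s' → rank b < rank s') →
                    ∀ u mid w → S (layer u) (layer w) → Walk u mid w →
                    All (λ z → layer z ≡ layer u ⊎ layer z ≡ layer w) mid
      walk-beside _≟_ no-detour u [] w _ _ = []
      walk-beside _≟_ no-detour u (z ∷ mid) w uw (r ∷ rs) with over r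
      ... | inj₁ same = inj₁ (sym same) ∷
            All.map (Sum.map₁ (λ e → trans e (sym same)))
                    (walk-beside _≟_ no-detour z mid w (subst (λ c → S c (layer w)) same uw) rs)
      ... | inj₂ s with layer z ≟ layer w
      ...   | yes z≡w = inj₂ z≡w ∷ All.map (λ e → inj₂ (trans e z≡w)) (walk-flat z mid w rs z≡w)
      ...   | no z≢w with walk-exit z mid w rs z≢w
      ...     | s' , step , le = ⊥-elim (<-irrefl refl (≤-trans (no-detour uw s z≢w step) le))

    module Criterion {C : Set} (layer : V → C) (S : C → C → Set) (rank : C → ℕ)
                     (rank-mono : ∀ {a b} → S a b → rank a < rank b)
                     (over : ∀ {u v} → R u v → layer u ≡ layer v ⊎ S (layer u) (layer v))
                     (_≟_ : DecidableEquality C)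
                     (no-detour : ∀ {a b s s'} → S a b → S a s → s ≢ b → S s s' → rank b < rank s')
                     {J : Set} (Region : J → V → Set) (φ : J → V → ℤ)
                     (rise : ∀ j {a b} → Region j a → Region j b → R a b → Rise (φ j a) (φ j b))
                     (covered : ∀ {u v} → R u v → Σ J λ j → Region j u × Region j v)
                     (saturated : ∀ j {u z} → Region j u → layer z ≡ layer u → Region j z) where

      open Layered layer S rank rank-mono over

      acyclic : Acyclic R
      acyclic u mid closed with first-arc mid closed
      ... | _ , r with covered r
      ... | j , ju , _ with Potential.walk-rise (Region j) (φ j) (rise j) u mid u closed ju
                              (All.map (saturated j ju) (walk-flat u mid u closed refl)) ju
      ... | suc k , _ , eq with rise-equal (φ j u) (trans (+-identityʳ (φ j u)) eq)
      ... | ()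

      no-shortcut : ∀ u w mid → Walk u mid w → R u w → AllPairs R (u ∷ (mid ∷ʳ w))
      no-shortcut u w mid path r with covered r
      ... | j , ju , jw = short mid path (Potential.walk-rise (Region j) (φ j) (rise j) u mid w path ju inner jw)
        where
          in-region : ∀ {z} → layer z ≡ layer u ⊎ layer z ≡ layer w → Region j z
          in-region (inj₁ e) = saturated j ju e
          in-region (inj₂ e) = saturated j jw e

          inner : All (Region j) mid
          inner with over r
          ... | inj₁ same = All.map (saturated j ju) (walk-flat u mid w path same)
          ... | inj₂ step = All.map in-region (walk-beside _≟_ no-detour u mid w step path)

          -- the arc u → w rises by at most two, so the path has at most one inner vertex
          short : ∀ mid → Walk u mid w → (Σ ℕ λ k → length mid < k × φ j w ≡ φ j u +ℤ + k) →
                  AllPairs R (u ∷ (mid ∷ʳ w))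
          short [] (r₁ ∷ [-]) _ = (r₁ ∷ []) ∷ [] ∷ []
          short (_ ∷ []) (r₁ ∷ r₂ ∷ [-]) _ = (r₁ ∷ r ∷ []) ∷ (r₂ ∷ []) ∷ [] ∷ []
          short (_ ∷ _ ∷ _) _ (k , 3+l≤k , eq) with rise j ju jw r
          ... | d , _ , d≤2 , eq' with rise-equal (φ j u) (trans (sym eq) eq')
          ... | refl = ⊥-elim (<-irrefl refl (≤-trans (≤-trans (s≤s (s≤s (s≤s z≤n))) 3+l≤k) d≤2))

      semi-transitive : SemiTransitive R
      semi-transitive = acyclic , no-shortcut

-- The columns 0 … M of G_{m,n} for m = K + 4.
module Columns (K : ℕ) where

  open import Data.Nat using (_+_; _*_; _≟_; _%_)
  open import Data.Nat.Properties
    using (m≤n⇒m<n∨m≡n; ≤-pred; suc-injective; +-comm; +-suc; m+1+n≰m; ≤ᵇ⇒≤; ≤⇒≤ᵇ;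
           <⇒≢; ≤-trans; n≤1+n; <-irrefl; *-monoʳ-<; n<1+n; 1+n≢n)
  open import Data.Nat.DivMod using (m<n⇒m%n≡m; n%n≡0)
  open import Data.Fin.Properties using (toℕ-fromℕ<; toℕ<n)
  open import Data.Bool using (T)

  M : ℕ
  M = 3 + K

  Col : Set
  Col = Fin (suc M)

  data Succ : ℕ → ℕ → Set where
    step : ∀ {t} → t < M → Succ t (suc t)
    wrap : Succ M 0

  succ-view : (y : Col) → Succ (toℕ y) (toℕ (next y))
  succ-view y with m≤n⇒m<n∨m≡n (toℕ<n y)
  ... | inj₁ y<M = subst (Succ (toℕ y)) (sym toℕ-next) (step (≤-pred y<M))
    where toℕ-next = trans (toℕ-fromℕ< _) (m<n⇒m%n≡m y<M)
  ... | inj₂ y≡M = subst₂ Succ (sym (suc-injective y≡M)) (sym toℕ-next) wrap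
    where toℕ-next = trans (toℕ-fromℕ< _) (trans (cong (_% suc M) y≡M) (n%n≡0 (suc M)))

  -- As m ≥ 4, the cyclic successor has no cycles of length 1, 2 or 3
  -- (the absurd cases are refuted by unification alone).
  no-1-cycle : ∀ {a} → Succ a a → ⊥
  no-1-cycle ()

  no-2-cycle : ∀ {a b} → Succ a b → Succ b a → ⊥
  no-2-cycle (step _) ()
  no-2-cycle wrap ()

  no-3-cycle : ∀ {a b c} → Succ a b → Succ b c → Succ c a → ⊥
  no-3-cycle (step _) (step _) ()
  no-3-cycle (step _) wrap ()
  no-3-cycle wrap (step _) ()

  succ-injective : ∀ {a b c} → Succ a c → Succ b c → a ≡ b
  succ-injective (step _) (step _) = refl
  succ-injective wrap wrap = refl

  next-injective : (a b : Col) → next a ≡ next b → a ≡ b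
  next-injective a b e =
    toℕ-injective (succ-injective (succ-view a) (subst (Succ (toℕ b)) (cong toℕ (sym e)) (succ-view b)))

  next-irrefl : (y : Col) → next y ≢ y
  next-irrefl y e = no-1-cycle (subst (Succ (toℕ y)) (cong toℕ e) (succ-view y))

  next²-irrefl : (y : Col) → next (next y) ≢ y
  next²-irrefl y e =
    no-2-cycle (succ-view y) (subst (Succ (toℕ (next y))) (cong toℕ e) (succ-view (next y)))

  next³-irrefl : (y : Col) → next (next (next y)) ≢ y
  next³-irrefl y e = no-3-cycle (succ-view y) (succ-view (next y))
    (subst (Succ (toℕ (next (next y)))) (cong toℕ e) (succ-view (next (next y))))

  -- All edges of O between the columns y and y+1 point from column tail y to head y.
  tail head : Col → Col
  tail y = if forward y then y else next y
  head y = if forward y then next y else y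

  data ColStep : ℕ → ℕ → Set where
    ascend  : ∀ {t} → 2 + t ≤ M → ColStep t (suc t)
    descend : ColStep M (2 + K)
    wrap    : ColStep 0 M

  private
    forward-step : ∀ {a b} → Succ a b → a + 3 ≤ suc M → ColStep a b
    forward-step (step {t} _) t+3≤m = ascend (≤-pred (subst (_≤ suc M) (+-comm t 3) t+3≤m))
    forward-step wrap M+3≤m = ⊥-elim (m+1+n≰m (suc M) (subst (_≤ suc M) (+-suc M 2) M+3≤m))

    backward-step : ∀ {a b} → Succ a b → ¬ (a + 3 ≤ suc M) → ColStep b a
    backward-step (step {t} t<M) t+3≰m with m≤n⇒m<n∨m≡n t<M
    ... | inj₂ refl = descend
    ... | inj₁ t+1<M = ⊥-elim (t+3≰m (subst (_≤ suc M) (+-comm 3 t) (s≤s t+1<M)))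
    backward-step wrap _ = wrap

  tail-head-step : (y : Col) → ColStep (toℕ (tail y)) (toℕ (head y))
  tail-head-step y with forward y in fwd
  ... | true  = forward-step (succ-view y) (≤ᵇ⇒≤ (toℕ y + 3) (suc M) (subst T (sym fwd) _))
  ... | false = backward-step (succ-view y) (λ le → subst T fwd (≤⇒≤ᵇ le))

  -- A rank increasing along the column digraph, which orders the columns 0 < M < 1 < … < M-1.
  rank : ℕ → ℕ
  rank t = if does (t ≟ M) then 1 else 2 * t

  rank-last : rank M ≡ 1
  rank-last = cong (if_then 1 else (2 * M)) (dec-true (M ≟ M) refl)

  rank-other : ∀ {t} → t ≢ M → rank t ≡ 2 * t
  rank-other {t} t≢M = cong (if_then 1 else (2 * t)) (dec-false (t ≟ M) t≢M)

  private
    ascend-below : ∀ {t} → 2 + t ≤ M → t ≢ M × suc t ≢ M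
    ascend-below {t} 2+t≤M = <⇒≢ (≤-trans (n≤1+n (suc t)) 2+t≤M) , <⇒≢ 2+t≤M

    not-ascend-last : ¬ (2 + M ≤ M)
    not-ascend-last 2+M≤M = <-irrefl refl (≤-trans (n≤1+n (suc M)) 2+M≤M)

    2+K≢M : 2 + K ≢ M
    2+K≢M e = 1+n≢n (sym e)

  rank-mono : ∀ {a b} → ColStep a b → rank a < rank b
  rank-mono (ascend {t} 2+t≤M) =
    let t≢M , 1+t≢M = ascend-below 2+t≤M in
    subst₂ _<_ (sym (rank-other t≢M)) (sym (rank-other 1+t≢M)) (*-monoʳ-< 2 (n<1+n t))
  rank-mono descend = subst₂ _<_ (sym rank-last) (sym (rank-other 2+K≢M)) (s≤s (s≤s z≤n))
  rank-mono wrap = subst₂ _<_ (sym (rank-other {0} (λ ()))) (sym rank-last) (s≤s z≤n)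

  -- The column digraph has no detours: if a → b and a → s are distinct arcs, every
  -- column beyond s ranks above b (so b cannot be reached from s).
  no-detour : ∀ {a b s s'} → ColStep a b → ColStep a s → s ≢ b → ColStep s s' → rank b < rank s'
  no-detour (ascend _)  (ascend _)  s≢b _ = ⊥-elim (s≢b refl)
  no-detour descend     descend     s≢b _ = ⊥-elim (s≢b refl)
  no-detour wrap        wrap        s≢b _ = ⊥-elim (s≢b refl)
  no-detour (ascend p)  descend     _   _ = ⊥-elim (not-ascend-last p)
  no-detour descend     (ascend p)  _   _ = ⊥-elim (not-ascend-last p)
  no-detour (ascend _)  wrap        _   (ascend p) = ⊥-elim (not-ascend-last p)
  no-detour (ascend _)  wrap        _   descend =
    subst (2 <_) (sym (rank-other 2+K≢M)) (*-monoʳ-< 2 {1} {2 + K} (s≤s (s≤s z≤n)))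
  no-detour wrap        (ascend _)  _   (ascend _) = subst (_< 4) (sym rank-last) (s≤s (s≤s z≤n))

module Layers (K : ℕ) where

  open import Data.Fin.Properties using (suc-injective)
  open import Data.Bool.Properties using (xor-same)
  open Columns K

  private
    inject₁≢suc : ∀ {k} (i : Fin k) → inject₁ i ≢ suc i
    inject₁≢suc zero ()
    inject₁≢suc (suc i) e = inject₁≢suc i (suc-injective e)

    inject₁²≢suc² : ∀ {k} (i : Fin k) → inject₁ (inject₁ i) ≢ suc (suc i)
    inject₁²≢suc² zero ()
    inject₁²≢suc² (suc i) e = inject₁²≢suc² i (suc-injective e)

    module _ {n : ℕ} where
      rows-differ : ∀ {a b : Fin (suc n)} {c d : Col} → a ≢ b → does ((a , c) ≟V (b , d)) ≡ false
      rows-differ {a} {b} {c} {d} a≢b = dec-false ((a , c) ≟V (b , d)) (λ e → a≢b (cong proj₁ e))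

      cols-differ : ∀ {a b : Fin (suc n)} {c d : Col} → c ≢ d → does ((a , c) ≟V (b , d)) ≡ false
      cols-differ {a} {b} {c} {d} c≢d = dec-false ((a , c) ≟V (b , d)) (λ e → c≢d (cong proj₂ e))

      same-vertex : (v : Vtx (suc M) n) → does (v ≟V v) ≡ true
      same-vertex v = dec-true (v ≟V v) refl

  -- A cell of layer L_{x+2} has type A exactly when its diagonal is parallel to the
  -- diagonal of the cell below it: parallel diagonals of stacked cells share no vertex,
  -- the two diagonals of a "zigzag" share the middle one.
  type-A-iff-parallel : ∀ {n} (τ : Tri (suc M) (suc n)) (x : Fin n) (y : Col) →
                        isTypeA τ x y ≡ not (τ (suc x) y xor τ (inject₁ x) y)
  type-A-iff-parallel τ x y with τ (suc x) y | τ (inject₁ x) y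
  ... | true | true
    rewrite rows-differ {c = y} {d = y} (λ e → inject₁≢suc (inject₁ x) (sym e))
          | cols-differ {a = suc (inject₁ x)} {b = suc (inject₁ x)} (λ e → next-irrefl y (sym e))
          | rows-differ {c = next y} {d = y} (λ e → inject₁²≢suc² x (sym e))
          | rows-differ {c = next y} {d = next y} (λ e → inject₁≢suc x (sym (suc-injective e)))
          = refl
  ... | true | false rewrite same-vertex (suc (inject₁ x) , y) = refl
  ... | false | true
    rewrite rows-differ {c = y} {d = y} (λ e → inject₁²≢suc² x (sym e))
          | rows-differ {c = y} {d = next y} (λ e → inject₁≢suc x (sym (suc-injective e)))
          | rows-differ {c = next y} {d = y} (λ e → inject₁≢suc (inject₁ x) (sym e))
          | same-vertex (suc (inject₁ x) , next y)
          = refl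
  ... | false | false
    rewrite rows-differ {c = y} {d = y} (λ e → inject₁≢suc x (sym (suc-injective e)))
          | rows-differ {c = y} {d = next y} (λ e → inject₁²≢suc² x (sym e))
          | cols-differ {a = suc (inject₁ x)} {b = suc (inject₁ x)} (next-irrefl y)
          | rows-differ {c = next y} {d = next y} (λ e → inject₁≢suc (inject₁ x) (sym e))
          = refl

  private
    -- one step of the recursion defining up, in terms of parallelism
    parallel-step : ∀ a b c → (if not (c xor b) then not (a xor b) else not (not (a xor b))) ≡ not (a xor c)
    parallel-step true  true  true  = refl
    parallel-step true  true  false = refl
    parallel-step true  false true  = refl
    parallel-step true  false false = refl
    parallel-step false true  true  = refl
    parallel-step false true  false = refl
    parallel-step false false true  = refl
    parallel-step false false false = refl

  up-diagonal : ∀ {n} (τ : Tri (suc M) (suc n)) (x : Fin (suc n)) (y : Col) →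
                up τ x y ≡ not (τ zero y xor τ x y)
  up-diagonal τ zero y = sym (cong not (xor-same (τ zero y)))
  up-diagonal {suc n} τ (suc x) y
    rewrite type-A-iff-parallel τ x y | up-diagonal (restrict τ) x y =
      parallel-step (τ zero y) (τ (inject₁ x) y) (τ (suc x) y)

  -- All cells of each layer L_{x+2} have a common type.
  LayersUniform : ∀ {n} → Tri (suc M) (suc n) → Set
  LayersUniform {n} τ = ∀ (x : Fin n) (y : Col) →
    (τ (suc x) y xor τ (inject₁ x) y) ≡ (τ (suc x) (next y) xor τ (inject₁ x) (next y))

  up-uniform : ∀ {n} (τ : Tri (suc M) (suc n)) → LayersUniform τ → ∀ x y → up τ x y ≡ up τ x (next y)
  up-uniform τ uniform zero y = refl
  up-uniform {suc n} τ uniform (suc x) y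
    rewrite type-A-iff-parallel τ x y | type-A-iff-parallel τ x (next y) | uniform x y
          | up-uniform (restrict τ) (λ x' y' → uniform (inject₁ x') y') x y = refl

module Gains where

  open Walks using (Rise)
  open import Data.Integer using (ℤ; +_; -_; _+_)
  open import Data.Integer.Properties using (+-assoc; +-comm; +-identityˡ)

  sg : Bool → ℤ
  sg true  = + 1
  sg false = - (+ 1)

  heights : ∀ {n} → (Fin n → Bool) → Fin (suc n) → ℤ
  heights u zero = + 0
  heights {suc n} u (suc x) = heights (u ∘ inject₁) x + sg (u x)

  heights-inject₁ : ∀ {n} (u : Fin (suc n) → Bool) (x : Fin (suc n)) →
                    heights u (inject₁ x) ≡ heights (u ∘ inject₁) x
  heights-inject₁ u zero = refl
  heights-inject₁ {suc n} u (suc x) = cong (_+ sg (u (inject₁ x))) (heights-inject₁ (u ∘ inject₁) x)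

  heights-step : ∀ {n} (u : Fin (suc n) → Bool) (x : Fin (suc n)) →
                 heights u (suc x) ≡ heights u (inject₁ x) + sg (u x)
  heights-step u x = cong (_+ sg (u x)) (sym (heights-inject₁ u x))

  rise-shift : ∀ h {a b} → Rise a b → Rise (h + a) (h + b)
  rise-shift h {a} (d , 1≤d , d≤2 , eq) = d , 1≤d , d≤2 , trans (cong (λ z → h + z) eq) (sym (+-assoc h a (+ d)))

  -- Whether a diagonal of type t, oriented as the horizontals (forward = f), goes from
  -- the lower to the upper row of its cell.
  rises : Bool → Bool → Bool
  rises f t = if f then t else not t

  -- The jump of a ladder potential on the head column; g is the bottom diagonal.
  gap : Bool → Bool → ℤ
  gap f g = if f xor g then + 2 else + 1

  -- Potential on the lower (b = false) or upper (b = true) row of a cell, relative to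
  -- the lower row, when its vertical edges point upward iff u and the column offset is o.
  level : Bool → Bool → ℤ → ℤ
  level b u o = if b then sg u + o else o

  -- horizontal edges: the jump itself
  gap-gain : ∀ f g → Rise (+ 0) (gap f g)
  gap-gain true  true  = 1 , s≤s z≤n , s≤s z≤n , refl
  gap-gain true  false = 2 , s≤s z≤n , s≤s (s≤s z≤n) , refl
  gap-gain false true  = 2 , s≤s z≤n , s≤s (s≤s z≤n) , refl
  gap-gain false false = 1 , s≤s z≤n , s≤s z≤n , refl

  -- vertical edges: one step of height
  vertical-gain : ∀ u o → Rise (level (not u) u o) (level u u o)
  vertical-gain true  o = 1 , s≤s z≤n , s≤s z≤n , +-comm (+ 1) o
  vertical-gain false o = 1 , s≤s z≤n , s≤s z≤n , (begin
    o                      ≡⟨ sym (+-identityˡ o) ⟩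
    (- (+ 1) + + 1) + o    ≡⟨ +-assoc (- (+ 1)) (+ 1) o ⟩
    - (+ 1) + (+ 1 + o)    ≡⟨ cong (λ z → - (+ 1) + z) (+-comm (+ 1) o) ⟩
    - (+ 1) + (o + + 1)    ≡⟨ sym (+-assoc (- (+ 1)) o (+ 1)) ⟩
    (- (+ 1) + o) + + 1    ∎)
    where open ≡-Reasoning

  -- diagonal edges, when the vertical edges of the cell point upward iff its diagonal t
  -- is parallel to the bottom diagonal g: the jump compensates a descent of the diagonal
  diagonal-gain : ∀ f t g → Rise (level (not (rises f t)) (not (g xor t)) (+ 0))
                                 (level (rises f t) (not (g xor t)) (gap f g))
  diagonal-gain true  true  true  = 2 , s≤s z≤n , s≤s (s≤s z≤n) , refl
  diagonal-gain true  true  false = 1 , s≤s z≤n , s≤s z≤n , refl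
  diagonal-gain true  false true  = 2 , s≤s z≤n , s≤s (s≤s z≤n) , refl
  diagonal-gain true  false false = 1 , s≤s z≤n , s≤s z≤n , refl
  diagonal-gain false true  true  = 1 , s≤s z≤n , s≤s z≤n , refl
  diagonal-gain false true  false = 2 , s≤s z≤n , s≤s (s≤s z≤n) , refl
  diagonal-gain false false true  = 1 , s≤s z≤n , s≤s z≤n , refl
  diagonal-gain false false false = 2 , s≤s z≤n , s≤s (s≤s z≤n) , refl

module Ladders (K n : ℕ) (τ : Tri (suc (Columns.M K)) (suc n)) where

  open Walks using (Rise)
  open Gains
  open import Data.Integer using (ℤ; +_; _+_)
  open import Data.Integer.Properties using (+-assoc)
  open Columns K
  open Layers K

  V : Set
  V = Vtx (suc M) (suc n)

  col : V → Col
  col = proj₂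

  row : Fin (suc n) → Bool → Fin (suc (suc n))
  row x b = if b then suc x else inject₁ x

  orient-hor : ∀ x y → orient τ (hor x y) ≡ ((x , tail y) , (x , head y))
  orient-hor x y with forward y
  ... | true  = refl
  ... | false = refl

  orient-dia : ∀ x y → let r = rises (forward y) (τ x y) in
               orient τ (dia x y) ≡ ((row x (not r) , tail y) , (row x r , head y))
  orient-dia x y with forward y | τ x y
  ... | true  | true  = refl
  ... | true  | false = refl
  ... | false | true  = refl
  ... | false | false = refl

  orient-ver : ∀ x y → let u = up τ x y in
               orient τ (ver x y) ≡ ((row x (not u) , y) , (row x u , y))
  orient-ver x y with up τ x y
  ... | true  = refl
  ... | false = refl

  -- The ladder j: the columns j and j+1, which carry all edges of the cells (_ , j).
  Ladder : Col → Col → Set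
  Ladder j c = c ≡ j ⊎ c ≡ next j

  InLadder : Col → V → Set
  InLadder j v = Ladder j (col v)

  height : Col → Fin (suc (suc n)) → ℤ
  height j = heights (λ x → up τ x j)

  offset : Col → Col → ℤ
  offset j c = if does (c ≟ᶠ head j) then gap (forward j) (τ zero j) else + 0

  φ : Col → V → ℤ
  φ j (r , c) = height j r + offset j c

  tail≢head : ∀ j → tail j ≢ head j
  tail≢head j with forward j
  ... | true  = λ e → next-irrefl j (sym e)
  ... | false = next-irrefl j

  offset-head : ∀ j → offset j (head j) ≡ gap (forward j) (τ zero j)
  offset-head j = cong (if_then gap (forward j) (τ zero j) else + 0) (dec-true (head j ≟ᶠ head j) refl)

  offset-tail : ∀ j → offset j (tail j) ≡ + 0
  offset-tail j = cong (if_then gap (forward j) (τ zero j) else + 0) (dec-false (tail j ≟ᶠ head j) (tail≢head j))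

  φ-row : ∀ j x b c → φ j (row x b , c) ≡ height j (inject₁ x) + level b (up τ x j) (offset j c)
  φ-row j x false c = refl
  φ-row j x true c = trans (cong (_+ offset j c) (heights-step (λ x → up τ x j) x))
                           (+-assoc (height j (inject₁ x)) (sg (up τ x j)) (offset j c))

  RiseOn : Col → V × V → Set
  RiseOn j (u , v) = Rise (φ j u) (φ j v)

  hor-rise : ∀ x j → RiseOn j (orient τ (hor x j))
  hor-rise x j rewrite orient-hor x j | offset-tail j | offset-head j =
    rise-shift (height j x) (gap-gain (forward j) (τ zero j))

  dia-rise : ∀ x j → RiseOn j (orient τ (dia x j))
  dia-rise x j
    rewrite orient-dia x j
          | φ-row j x (not (rises (forward j) (τ x j))) (tail j)
          | φ-row j x (rises (forward j) (τ x j)) (head j)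
          | offset-tail j | offset-head j | up-diagonal τ x j =
    rise-shift (height j (inject₁ x)) (diagonal-gain (forward j) (τ x j) (τ zero j))

  -- the vertical edges of column j+1 need uniformity to agree with those of column j
  ver-rise : LayersUniform τ → ∀ x j c → Ladder j c → RiseOn j (orient τ (ver x c))
  ver-rise uniform x j c c∈j rewrite orient-ver x c | φ-row j x (not (up τ x c)) c | φ-row j x (up τ x c) c
    with c∈j
  ... | inj₁ refl = rise-shift (height j (inject₁ x)) (vertical-gain (up τ x j) (offset j j))
  ... | inj₂ refl rewrite sym (up-uniform τ uniform x j) =
    rise-shift (height j (inject₁ x)) (vertical-gain (up τ x j) (offset j (next j)))

  private
    tail-head : ∀ y → (tail y ≡ y × head y ≡ next y) ⊎ (tail y ≡ next y × head y ≡ y)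
    tail-head y with forward y
    ... | true  = inj₁ (refl , refl)
    ... | false = inj₂ (refl , refl)

    columns-of-ladder : ∀ {y j} → Ladder j y → Ladder j (next y) → y ≡ j
    columns-of-ladder (inj₁ y≡j) _ = y≡j
    columns-of-ladder {j = j} (inj₂ refl) (inj₁ e) = ⊥-elim (next²-irrefl j e)
    columns-of-ladder {y} {j} (inj₂ _) (inj₂ e) = next-injective y j e

    crossing-in-ladder : ∀ y {j} → Ladder j (tail y) → Ladder j (head y) → y ≡ j
    crossing-in-ladder y t∈j h∈j with tail-head y
    ... | inj₁ (t≡y , h≡y+1) = columns-of-ladder (subst (Ladder _) t≡y t∈j) (subst (Ladder _) h≡y+1 h∈j)
    ... | inj₂ (t≡y+1 , h≡y) = columns-of-ladder (subst (Ladder _) h≡y h∈j) (subst (Ladder _) t≡y+1 t∈j)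

    crossing-ladder : ∀ y → Ladder y (tail y) × Ladder y (head y)
    crossing-ladder y with tail-head y
    ... | inj₁ (t≡y , h≡y+1) = inj₁ t≡y , inj₂ h≡y+1
    ... | inj₂ (t≡y+1 , h≡y) = inj₂ t≡y+1 , inj₁ h≡y

  arc-over : ∀ {u v} → Arc τ u v → col u ≡ col v ⊎ ColStep (toℕ (col u)) (toℕ (col v))
  arc-over (hor x y , eq) with trans (sym (orient-hor x y)) eq
  ... | refl = inj₂ (tail-head-step y)
  arc-over (dia x y , eq) with trans (sym (orient-dia x y)) eq
  ... | refl = inj₂ (tail-head-step y)
  arc-over (ver x y , eq) with trans (sym (orient-ver x y)) eq
  ... | refl = inj₁ refl

  arc-ladder : ∀ {u v} → Arc τ u v → Σ Col λ j → InLadder j u × InLadder j v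
  arc-ladder (hor x y , eq) with trans (sym (orient-hor x y)) eq
  ... | refl = y , crossing-ladder y
  arc-ladder (dia x y , eq) with trans (sym (orient-dia x y)) eq
  ... | refl = y , crossing-ladder y
  arc-ladder (ver x y , eq) with trans (sym (orient-ver x y)) eq
  ... | refl = y , inj₁ refl , inj₁ refl

  arc-rise : LayersUniform τ → ∀ j {u v} → InLadder j u → InLadder j v → Arc τ u v → Rise (φ j u) (φ j v)
  arc-rise _ j u∈j v∈j (hor x y , eq) with trans (sym (orient-hor x y)) eq
  ... | refl with crossing-in-ladder y u∈j v∈j
  ... | refl = subst (RiseOn j) (orient-hor x j) (hor-rise x j)
  arc-rise _ j u∈j v∈j (dia x y , eq) with trans (sym (orient-dia x y)) eq
  ... | refl with crossing-in-ladder y u∈j v∈j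
  ... | refl = subst (RiseOn j) (orient-dia x j) (dia-rise x j)
  arc-rise uniform j u∈j v∈j (ver x y , eq) with trans (sym (orient-ver x y)) eq
  ... | refl = subst (RiseOn j) (orient-ver x y) (ver-rise uniform x j y u∈j)

-- Induced wheels in a block of 2 × 2 cells, found by computation.
module Blocks where

  open import Data.Fin.Properties using (any?; all?)
  open import Data.Product using (∃)
  open import Data.Product.Properties using (≡-dec)
  open import Data.Unit using (tt)
  open import Data.Vec using (Vec; []; _∷_; lookup)
  open import Function using (Injective)
  open import Function.Bundles using (_⇔_; mk⇔; Equivalence)
  open import Relation.Nullary.Decidable using (map′; _⊎-dec_; _×-dec_; _→-dec_; True; toWitness)

  iff? : ∀ {P Q : Set} → Dec P → Dec Q → Dec (P ⇔ Q)
  iff? p? q? = map′ (λ (f , g) → mk⇔ f g) (λ e → Equivalence.to e , Equivalence.from e)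
                    ((p? →-dec q?) ×-dec (q? →-dec p?))

  module _ {V : Set} (_≟_ : DecidableEquality V) (A : V → V → Set) (A? : ∀ p q → Dec (A p q)) where

    embeds? : ∀ {h} (H : Fin h → Fin h → Set) → (∀ a b → Dec (H a b)) → (f : Fin h → V) →
              Dec (Injective _≡_ _≡_ f × (∀ a b → H a b ⇔ A (f a) (f b)))
    embeds? H H? f = injective? ×-dec all? (λ a → all? (λ b → iff? (H? a b) (A? (f a) (f b))))
      where injective? = map′ (λ inj {a} {b} → inj a b) (λ inj a b → inj)
                              (all? (λ a → all? (λ b → (f a ≟ f b) →-dec (a ≟ᶠ b))))

    induced-by-check : ∀ {h} (H : Fin h → Fin h → Set) (H? : ∀ a b → Dec (H a b)) (f : Fin h → V) →
                       True (embeds? H H? f) → InducedSub A H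
    induced-by-check H H? f ok = f , toWitness ok

  induced-compose : ∀ {V W : Set} {A : V → V → Set} {B : W → W → Set} {h} {H : Fin h → Fin h → Set} →
                    (e : V → W) → Injective _≡_ _≡_ e → (∀ p q → A p q ⇔ B (e p) (e q)) →
                    InducedSub A H → InducedSub B H
  induced-compose e e-inj e-iso (f , f-inj , f-iso) =
    (λ a → e (f a)) , (λ eq → f-inj (e-inj eq)) ,
    λ a b → mk⇔ (λ h → Equivalence.to (e-iso (f a) (f b)) (Equivalence.to (f-iso a b) h))
                (λ adj → Equivalence.from (f-iso a b) (Equivalence.from (e-iso (f a) (f b)) adj))

  wheel? : ∀ k (a b : Fin (suc k)) → Dec (WheelAdj k a b)
  wheel? k zero    zero    = no (λ ())
  wheel? k zero    (suc j) = yes tt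
  wheel? k (suc i) zero    = yes tt
  wheel? k (suc i) (suc j) = (j ≟ᶠ next i) ⊎-dec (i ≟ᶠ next j)

  -- The 3 × 3 vertices (row , column) of a block of 2 × 2 cells and its edges; d i k is
  -- the diagonal of the cell (i , k), encoded as in Tri.
  Pos : Set
  Pos = Fin 3 × Fin 3

  data BlockEdge : Set where
    bhor : Fin 3 → Fin 2 → BlockEdge
    bver : Fin 2 → Fin 3 → BlockEdge
    bdia : Fin 2 → Fin 2 → BlockEdge

  block-ends : (Fin 2 → Fin 2 → Bool) → BlockEdge → Pos × Pos
  block-ends d (bhor i k) = (i , inject₁ k) , (i , suc k)
  block-ends d (bver i k) = (inject₁ i , k) , (suc i , k)
  block-ends d (bdia i k) = if d i k then ((inject₁ i , inject₁ k) , (suc i , suc k))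
                                     else ((suc i , inject₁ k) , (inject₁ i , suc k))

  BlockAdj : (Fin 2 → Fin 2 → Bool) → Pos → Pos → Set
  BlockAdj d p q = Σ BlockEdge λ e → block-ends d e ≡ (p , q) ⊎ block-ends d e ≡ (q , p)

  _≟P_ : DecidableEquality Pos
  _≟P_ = ≡-dec _≟ᶠ_ _≟ᶠ_

  any-edge? : {P : BlockEdge → Set} → (∀ e → Dec (P e)) → Dec (Σ BlockEdge P)
  any-edge? {P} P? = map′ to from (by bhor ⊎-dec by bver ⊎-dec by bdia)
    where
      by : ∀ {r s} (c : Fin r → Fin s → BlockEdge) → Dec (∃ λ i → ∃ λ k → P (c i k))
      by c = any? (λ i → any? (λ k → P? (c i k)))
      to : _ → Σ BlockEdge P
      to (inj₁ (i , k , p))        = bhor i k , p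
      to (inj₂ (inj₁ (i , k , p))) = bver i k , p
      to (inj₂ (inj₂ (i , k , p))) = bdia i k , p
      from : Σ BlockEdge P → _
      from (bhor i k , p) = inj₁ (i , k , p)
      from (bver i k , p) = inj₂ (inj₁ (i , k , p))
      from (bdia i k , p) = inj₂ (inj₂ (i , k , p))

  block-adj? : ∀ d p q → Dec (BlockAdj d p q)
  block-adj? d p q = any-edge? (λ e → (block-ends d e ≟E (p , q)) ⊎-dec (block-ends d e ≟E (q , p)))
    where _≟E_ = ≡-dec _≟P_ _≟P_

  cells : Bool → Bool → Bool → Bool → Fin 2 → Fin 2 → Bool
  cells a b c d zero       zero       = a
  cells a b c d zero       (suc zero) = b
  cells a b c d (suc zero) zero       = c
  cells a b c d (suc zero) (suc zero) = d

  -- a hub followed by its rim, checked to form an induced wheel of the block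
  wheel : ∀ {k} d (ps : Vec Pos (suc k)) →
          True (embeds? _≟P_ (BlockAdj d) (block-adj? d) (WheelAdj k) (wheel? k) (lookup ps)) →
          InducedSub (BlockAdj d) (WheelAdj k)
  wheel {k} d ps = induced-by-check _≟P_ (BlockAdj d) (block-adj? d) (WheelAdj k) (wheel? k) (lookup ps)

  module _ where
    import Data.Nat.Literals as ℕ
    import Data.Fin.Literals as Fin
    open import Agda.Builtin.FromNat using (Number; fromNat)

    instance
      ℕ-literals : Number ℕ
      ℕ-literals = ℕ.number

      fin-literals : ∀ {n} → Number (Fin n)
      fin-literals {n} = Fin.number n

    -- If the two columns of cells of a block differ in type, the block contains an
    -- induced W5 or W7 centred at its middle vertex.
    block-wheel : ∀ a b c d → (c xor a) ≢ (d xor b) →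
                  InducedSub (BlockAdj (cells a b c d)) (WheelAdj 5) ⊎
                  InducedSub (BlockAdj (cells a b c d)) (WheelAdj 7)
    block-wheel true  true  true  true  differ = ⊥-elim (differ refl)
    block-wheel true  true  true  false _ =
      inj₁ (wheel _ ((1 , 1) ∷ (0 , 1) ∷ (1 , 2) ∷ (2 , 1) ∷ (1 , 0) ∷ (0 , 0) ∷ []) _)
    block-wheel true  true  false true  _ =
      inj₂ (wheel _ ((1 , 1) ∷ (0 , 1) ∷ (1 , 2) ∷ (2 , 2) ∷ (2 , 1) ∷ (2 , 0) ∷ (1 , 0) ∷ (0 , 0) ∷ []) _)
    block-wheel true  true  false false differ = ⊥-elim (differ refl)
    block-wheel true  false true  true  _ =
      inj₂ (wheel _ ((1 , 1) ∷ (0 , 1) ∷ (0 , 2) ∷ (1 , 2) ∷ (2 , 2) ∷ (2 , 1) ∷ (1 , 0) ∷ (0 , 0) ∷ []) _)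
    block-wheel true  false true  false differ = ⊥-elim (differ refl)
    block-wheel true  false false true  differ = ⊥-elim (differ refl)
    block-wheel true  false false false _ =
      inj₂ (wheel _ ((1 , 1) ∷ (0 , 1) ∷ (0 , 2) ∷ (1 , 2) ∷ (2 , 1) ∷ (2 , 0) ∷ (1 , 0) ∷ (0 , 0) ∷ []) _)
    block-wheel false true  true  true  _ =
      inj₁ (wheel _ ((1 , 1) ∷ (0 , 1) ∷ (1 , 2) ∷ (2 , 2) ∷ (2 , 1) ∷ (1 , 0) ∷ []) _)
    block-wheel false true  true  false differ = ⊥-elim (differ refl)
    block-wheel false true  false true  differ = ⊥-elim (differ refl)
    block-wheel false true  false false _ =
      inj₁ (wheel _ ((1 , 1) ∷ (0 , 1) ∷ (1 , 2) ∷ (2 , 1) ∷ (2 , 0) ∷ (1 , 0) ∷ []) _)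
    block-wheel false false true  true  differ = ⊥-elim (differ refl)
    block-wheel false false true  false _ =
      inj₁ (wheel _ ((1 , 1) ∷ (0 , 1) ∷ (0 , 2) ∷ (1 , 2) ∷ (2 , 1) ∷ (1 , 0) ∷ []) _)
    block-wheel false false false true  _ =
      inj₂ (wheel _ ((1 , 1) ∷ (0 , 1) ∷ (0 , 2) ∷ (1 , 2) ∷ (2 , 2) ∷ (2 , 1) ∷ (2 , 0) ∷ (1 , 0) ∷ []) _)
    block-wheel false false false false differ = ⊥-elim (differ refl)

module Embedding (K n : ℕ) (τ : Tri (suc (Columns.M K)) (suc n)) (x : Fin n) (y : Columns.Col K) where

  open import Data.Nat using (_+_)
  open import Data.Nat.Properties using (+-cancelʳ-≡)
  open import Data.Fin.Properties using (toℕ-inject₁)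
  open import Function using (Injective)
  open import Function.Bundles using (_⇔_; mk⇔)
  open Columns K
  open Blocks

  rowpos : Fin 3 → Fin (suc (suc n))
  rowpos zero             = inject₁ (inject₁ x)
  rowpos (suc zero)       = suc (inject₁ x)
  rowpos (suc (suc zero)) = suc (suc x)

  cellrow : Fin 2 → Fin (suc n)
  cellrow zero       = inject₁ x
  cellrow (suc zero) = suc x

  colpos : Fin 3 → Col
  colpos zero             = y
  colpos (suc zero)       = next y
  colpos (suc (suc zero)) = next (next y)

  place : Pos → Vtx (suc M) (suc n)
  place (i , k) = rowpos i , colpos k

  private
    rowpos-toℕ : ∀ i → toℕ (rowpos i) ≡ toℕ i + toℕ x
    rowpos-toℕ zero             = trans (toℕ-inject₁ (inject₁ x)) (toℕ-inject₁ x)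
    rowpos-toℕ (suc zero)       = cong suc (toℕ-inject₁ x)
    rowpos-toℕ (suc (suc zero)) = refl

    rowpos-injective : ∀ i i' → rowpos i ≡ rowpos i' → i ≡ i'
    rowpos-injective i i' e = toℕ-injective (+-cancelʳ-≡ (toℕ x) (toℕ i) (toℕ i')
      (trans (sym (rowpos-toℕ i)) (trans (cong toℕ e) (rowpos-toℕ i'))))

    rows-adjacent : ∀ i i' {z} → rowpos i ≡ inject₁ z → rowpos i' ≡ suc z → toℕ i' ≡ suc (toℕ i)
    rows-adjacent i i' {z} e e' = +-cancelʳ-≡ (toℕ x) (toℕ i') (suc (toℕ i)) (begin
      toℕ i' + toℕ x          ≡⟨ sym (rowpos-toℕ i') ⟩
      toℕ (rowpos i')         ≡⟨ cong toℕ e' ⟩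
      suc (toℕ z)             ≡⟨ cong suc (sym (toℕ-inject₁ z)) ⟩
      suc (toℕ (inject₁ z))   ≡⟨ cong suc (cong toℕ (sym e)) ⟩
      suc (toℕ (rowpos i))    ≡⟨ cong suc (rowpos-toℕ i) ⟩
      suc (toℕ i + toℕ x)     ∎)
      where open ≡-Reasoning

    row-step : ∀ i i' {z} → rowpos i ≡ inject₁ z → rowpos i' ≡ suc z →
               Σ (Fin 2) λ i₀ → i ≡ inject₁ i₀ × i' ≡ suc i₀ × z ≡ cellrow i₀
    row-step i i' e e' with rows-adjacent i i' e e'
    row-step zero       (suc zero)       e _ | _ = zero , refl , refl , inject₁-injective (sym e)
    row-step (suc zero) (suc (suc zero)) e _ | _ = suc zero , refl , refl , inject₁-injective (sym e)
    row-step zero             zero             _ _ | ()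
    row-step zero             (suc (suc zero)) _ _ | ()
    row-step (suc zero)       zero             _ _ | ()
    row-step (suc zero)       (suc zero)       _ _ | ()
    row-step (suc (suc zero)) zero             _ _ | ()
    row-step (suc (suc zero)) (suc zero)       _ _ | ()
    row-step (suc (suc zero)) (suc (suc zero)) _ _ | ()

    colpos-injective : ∀ k k' → colpos k ≡ colpos k' → k ≡ k'
    colpos-injective zero             zero             _ = refl
    colpos-injective (suc zero)       (suc zero)       _ = refl
    colpos-injective (suc (suc zero)) (suc (suc zero)) _ = refl
    colpos-injective zero             (suc zero)       e = ⊥-elim (next-irrefl y (sym e))
    colpos-injective zero             (suc (suc zero)) e = ⊥-elim (next²-irrefl y (sym e))
    colpos-injective (suc zero)       zero             e = ⊥-elim (next-irrefl y e)
    colpos-injective (suc zero)       (suc (suc zero)) e = ⊥-elim (next-irrefl y (sym (next-injective _ _ e)))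
    colpos-injective (suc (suc zero)) zero             e = ⊥-elim (next²-irrefl y e)
    colpos-injective (suc (suc zero)) (suc zero)       e = ⊥-elim (next-irrefl y (next-injective _ _ e))

    col-step : ∀ k k' → next (colpos k) ≡ colpos k' → Σ (Fin 2) λ k₀ → k ≡ inject₁ k₀ × k' ≡ suc k₀
    col-step zero             (suc zero)       _ = zero , refl , refl
    col-step (suc zero)       (suc (suc zero)) _ = suc zero , refl , refl
    col-step zero             zero             e = ⊥-elim (next-irrefl y e)
    col-step zero             (suc (suc zero)) e = ⊥-elim (next-irrefl y (sym (next-injective _ _ e)))
    col-step (suc zero)       zero             e = ⊥-elim (next²-irrefl y e)
    col-step (suc zero)       (suc zero)       e = ⊥-elim (next-irrefl (next y) e)
    col-step (suc (suc zero)) zero             e = ⊥-elim (next³-irrefl y e)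
    col-step (suc (suc zero)) (suc zero)       e = ⊥-elim (next²-irrefl y (next-injective _ _ e))
    col-step (suc (suc zero)) (suc (suc zero)) e = ⊥-elim (next-irrefl (next (next y)) e)

  place-injective : Injective _≡_ _≡_ place
  place-injective {i , k} {i' , k'} e
    with rowpos-injective i i' (cong proj₁ e) | colpos-injective k k' (cong proj₂ e)
  ... | refl | refl = refl

  module _ (d : Fin 2 → Fin 2 → Bool) (diagonals : ∀ i k → τ (cellrow i) (colpos (inject₁ k)) ≡ d i k) where

    private
      place² : Pos × Pos → Vtx (suc M) (suc n) × Vtx (suc M) (suc n)
      place² (p , q) = place p , place q

      global : BlockEdge → Edge (suc M) (suc n)
      global (bhor i k) = hor (rowpos i) (colpos (inject₁ k))
      global (bver i k) = ver (cellrow i) (colpos k)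
      global (bdia i k) = dia (cellrow i) (colpos (inject₁ k))

      rowpos-lower : ∀ i → rowpos (inject₁ i) ≡ inject₁ (cellrow i)
      rowpos-lower zero       = refl
      rowpos-lower (suc zero) = refl

      rowpos-upper : ∀ i → rowpos (suc i) ≡ suc (cellrow i)
      rowpos-upper zero       = refl
      rowpos-upper (suc zero) = refl

      colpos-suc : ∀ k → colpos (suc k) ≡ next (colpos (inject₁ k))
      colpos-suc zero       = refl
      colpos-suc (suc zero) = refl

      global-ends : ∀ e → ends τ (global e) ≡ place² (block-ends d e)
      global-ends (bhor i k) rewrite colpos-suc k = refl
      global-ends (bver i k) rewrite rowpos-lower i | rowpos-upper i = refl
      global-ends (bdia i k) rewrite diagonals i k with d i k
      ... | true  rewrite rowpos-lower i | rowpos-upper i | colpos-suc k = refl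
      ... | false rewrite rowpos-lower i | rowpos-upper i | colpos-suc k = refl

      endpoints : ∀ {r c r' c' i k i' k'} → ((r , c) , (r' , c')) ≡ (place (i , k) , place (i' , k')) →
                  r ≡ rowpos i × c ≡ colpos k × r' ≡ rowpos i' × c' ≡ colpos k'
      endpoints refl = refl , refl , refl , refl

      diagonal-ends : ∀ i k {t} → d i k ≡ t → block-ends d (bdia i k) ≡
                      (if t then ((inject₁ i , inject₁ k) , (suc i , suc k)) else ((suc i , inject₁ k) , (inject₁ i , suc k)))
      diagonal-ends i k eq rewrite eq = refl

      diagonal-value : ∀ {r c i₀ k₀ t} → r ≡ cellrow i₀ → c ≡ colpos (inject₁ k₀) → τ r c ≡ t → d i₀ k₀ ≡ t
      diagonal-value {i₀ = i₀} {k₀} r≡ c≡ τ≡ = trans (sym (diagonals i₀ k₀)) (trans (cong₂ τ (sym r≡) (sym c≡)) τ≡)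

      decode : ∀ e p q → ends τ e ≡ (place p , place q) → Σ BlockEdge λ b → block-ends d b ≡ (p , q)
      decode (hor r c) (i , k) (i' , k') eq with endpoints {i = i} {k} {i'} {k'} eq
      ... | r≡ , c≡ , r≡' , c≡'
        with rowpos-injective i i' (trans (sym r≡) r≡') | col-step k k' (trans (cong next (sym c≡)) c≡')
      ... | refl | k₀ , refl , refl = bhor i k₀ , refl
      decode (ver r c) (i , k) (i' , k') eq with endpoints {i = i} {k} {i'} {k'} eq
      ... | r≡ , c≡ , r≡' , c≡'
        with colpos-injective k k' (trans (sym c≡) c≡') | row-step i i' (sym r≡) (sym r≡')
      ... | refl | i₀ , refl , refl , _ = bver i₀ k , refl
      decode (dia r c) (i , k) (i' , k') eq with τ r c in τ≡
      ... | true with endpoints {i = i} {k} {i'} {k'} eq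
      ...   | r≡ , c≡ , r≡' , c≡'
        with row-step i i' (sym r≡) (sym r≡') | col-step k k' (trans (cong next (sym c≡)) c≡')
      ...   | i₀ , refl , refl , r≡₀ | k₀ , refl , refl =
        bdia i₀ k₀ , diagonal-ends i₀ k₀ (diagonal-value r≡₀ c≡ τ≡)
      decode (dia r c) (i , k) (i' , k') eq | false with endpoints {i = i} {k} {i'} {k'} eq
      ...   | r≡ , c≡ , r≡' , c≡'
        with row-step i' i (sym r≡') (sym r≡) | col-step k k' (trans (cong next (sym c≡)) c≡')
      ...   | i₀ , refl , refl , r≡₀ | k₀ , refl , refl =
        bdia i₀ k₀ , diagonal-ends i₀ k₀ (diagonal-value r≡₀ c≡ τ≡)

    block-iso : ∀ p q → BlockAdj d p q ⇔ Adj τ (place p) (place q)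
    block-iso p q = mk⇔ to from
      where
        to : BlockAdj d p q → Adj τ (place p) (place q)
        to (e , inj₁ eq) = global e , inj₁ (trans (global-ends e) (cong place² eq))
        to (e , inj₂ eq) = global e , inj₂ (trans (global-ends e) (cong place² eq))
        from : Adj τ (place p) (place q) → BlockAdj d p q
        from (e , inj₁ eq) = let b , eq' = decode e p q eq in b , inj₁ eq'
        from (e , inj₂ eq) = let b , eq' = decode e q p eq in b , inj₂ eq'

-- With uniform layers, O is semi-transitive: it lies over the ranked column digraph
-- without detours, and the ladders cover it with their potentials.
semi-transitive-if-uniform : ∀ K n (τ : Tri (suc (Columns.M K)) (suc n)) →
                             Layers.LayersUniform K τ → SemiTransitive (Arc τ)
semi-transitive-if-uniform K n τ uniform =
  Walks.Criterion.semi-transitive (Arc τ) col (λ a b → ColStep (toℕ a) (toℕ b)) (rank ∘ toℕ)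
    rank-mono arc-over _≟ᶠ_ (λ ab as s≢b → no-detour ab as (s≢b ∘ toℕ-injective))
    InLadder φ (arc-rise uniform) arc-ladder (λ j u∈j z≡u → subst (Ladder j) (sym z≡u) u∈j)
  where open Columns K
        open Ladders K n τ

block-in-τ : ∀ K n (τ : Tri (suc (Columns.M K)) (suc n)) x y {h} {H : Fin h → Fin h → Set} →
             let y' = next y in
             InducedSub (Blocks.BlockAdj (Blocks.cells (τ (inject₁ x) y) (τ (inject₁ x) y') (τ (suc x) y) (τ (suc x) y'))) H →
             InducedSub (Adj τ) H
block-in-τ K n τ x y = Blocks.induced-compose {B = Adj τ} place place-injective (block-iso _ diagonals)
  where
    open Embedding K n τ x y
    diagonals : ∀ i k → τ (cellrow i) (colpos (inject₁ k)) ≡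
                Blocks.cells (τ (inject₁ x) y) (τ (inject₁ x) (next y)) (τ (suc x) y) (τ (suc x) (next y)) i k
    diagonals zero       zero       = refl
    diagonals zero       (suc zero) = refl
    diagonals (suc zero) zero       = refl
    diagonals (suc zero) (suc zero) = refl

-- Without induced W5 and W7 the layers are uniform: a block of four cells whose
-- columns differ in type would contain one of these wheels.
uniform-if-no-wheels : ∀ K n (τ : Tri (suc (Columns.M K)) (suc n)) →
                       ¬ InducedSub (Adj τ) (WheelAdj 5) → ¬ InducedSub (Adj τ) (WheelAdj 7) →
                       Layers.LayersUniform K τ
uniform-if-no-wheels K n τ no-W5 no-W7 x y
  with (τ (suc x) y xor τ (inject₁ x) y) ≟ᵇ (τ (suc x) (next y) xor τ (inject₁ x) (next y))
... | yes same = same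
... | no differ with Blocks.block-wheel _ _ _ _ differ
...   | inj₁ W5 = ⊥-elim (no-W5 (block-in-τ K n τ x y W5))
...   | inj₂ W7 = ⊥-elim (no-W7 (block-in-τ K n τ x y W7))

lemma5 : (m n : ℕ) → 4 ≤ m → 1 ≤ n → (T : Tri m n) →
         ¬ InducedSub (Adj T) (WheelAdj 5) →
         ¬ InducedSub (Adj T) (WheelAdj 7) →
         SemiTransitive (Arc T)
lemma5 (suc (suc (suc (suc K)))) (suc n) _ _ T no-W5 no-W7 =
  semi-transitive-if-uniform K n T (uniform-if-no-wheels K n T no-W5 no-W7)
lemma5 (suc (suc (suc (suc K)))) zero _ () _ _ _
lemma5 zero _ () _ _ _ _
lemma5 (suc zero) _ (s≤s ()) _ _ _
lemma5 (suc (suc zero)) _ (s≤s (s≤s ())) _ _ _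
lemma5 (suc (suc (suc zero))) _ (s≤s (s≤s (s≤s ()))) _ _ _
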